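{- Every bipartite hook graph is a stabbable grid intersection graph.
   Context: A grid intersection graph (GIG) is the intersection graph of a finite family of horizontal and vertical line segments in the plane in which no two parallel segments intersect (vertices correspond to segments, adjacent iff the segments intersect); such a family is a GIG representation. A graph is a stabbable GIG (StabGIG) if it has a GIG representation together with a straight line in the plane that intersects every segment of the representation. A hook is the union of a horizontal segment and a vertical segment such that the left endpoint of the horizontal segment coincides with the top endpoint of the vertical segment; this common point is the center of the hook. A hook graph is the intersection graph of a finite family of hooks whose centers all lie on a common line of positive slope. A bipartite hook graph is a hook graph that is bipartite.
   Formalization: The hooks and the line of positive slope through their centers have rational coordinates, and the segments and stabbing line of the stabbable representation are likewise taken over ℚ. -}

module Defs where

open import Data.Nat using (ℕ)
open import Data.Bool using (Bool)
open import Data.Fin using (Fin)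
open import Data.Product using (Σ; ∃; _×_; _,_)
open import Data.Sum using (_⊎_)
open import Data.Rational using (ℚ; 0ℚ; _+_; _-_; _*_; _≤_; _<_)
open import Relation.Binary.PropositionalEquality using (_≡_; _≢_)
open import Relation.Nullary using (¬_)
open import Data.Unit using (⊤)
open import Data.Empty using (⊥)
open import Function.Bundles using (_⇔_)

record Graph (n : ℕ) : Set₁ where
  field
    Adj    : Fin n → Fin n → Set
    sym    : ∀ {i j} → Adj i j → Adj j i
    irrefl : ∀ {i} → ¬ Adj i i
open Graph public

Bipartite : ∀ {n} → Graph n → Set
Bipartite {n} G = Σ (Fin n → Bool) λ c → ∀ i j → Adj G i j → c i ≢ c j

Point : Set
Point = ℚ × ℚ

record NVLine : Set where
  constructor nvline
  field
    slope intercept : ℚ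

OnNVLine : NVLine → Point → Set
OnNVLine (nvline a b) (x , y) = y ≡ a * x + b

record Line : Set where
  constructor line
  field
    a b c  : ℚ
    nondeg : ¬ (a ≡ 0ℚ × b ≡ 0ℚ)

OnLine : Line → Point → Set
OnLine (line a b c _) (x , y) = a * x + b * y ≡ c

data Segment : Set where
  hor  : (y x₁ x₂ : ℚ) → x₁ ≤ x₂ → Segment
  vert : (x y₁ y₂ : ℚ) → y₁ ≤ y₂ → Segment

OnSeg : Segment → Point → Set
OnSeg (hor y x₁ x₂ _)  (px , py) = py ≡ y × (x₁ ≤ px × px ≤ x₂)
OnSeg (vert x y₁ y₂ _) (px , py) = px ≡ x × (y₁ ≤ py × py ≤ y₂)

SegsMeet : Segment → Segment → Set
SegsMeet s t = Σ Point λ p → OnSeg s p × OnSeg t p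

Parallel : Segment → Segment → Set
Parallel (hor _ _ _ _)  (hor _ _ _ _)  = ⊤
Parallel (vert _ _ _ _) (vert _ _ _ _) = ⊤
Parallel _ _ = ⊥

IsGIGRep : ∀ {n} → Graph n → (Fin n → Segment) → Set
IsGIGRep {n} G s =
  (∀ i j → i ≢ j → Parallel (s i) (s j) → ¬ SegsMeet (s i) (s j)) ×
  (∀ i j → i ≢ j → (Adj G i j ⇔ SegsMeet (s i) (s j)))

IsGIG : ∀ {n} → Graph n → Set
IsGIG {n} G = Σ (Fin n → Segment) λ s → IsGIGRep G s

IsStabGIG : ∀ {n} → Graph n → Set
IsStabGIG {n} G = Σ (Fin n → Segment) λ s → IsGIGRep G s ×
  Σ Line λ L → ∀ i → Σ Point λ p → OnSeg (s i) p × OnLine L p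

-- Hooks: center (cx , cy), horizontal segment from the center to the
-- right of length hlen, vertical segment from the center downwards of
-- length vlen.

record Hook : Set where
  constructor hook
  field
    cx cy hlen vlen : ℚ
    hlen≥0 : 0ℚ ≤ hlen
    vlen≥0 : 0ℚ ≤ vlen

center : Hook → Point
center h = Hook.cx h , Hook.cy h

OnHook : Hook → Point → Set
OnHook (hook cx cy hl vl _ _) (px , py) =
  (py ≡ cy × (cx ≤ px × px ≤ cx + hl)) ⊎
  (px ≡ cx × (cy - vl ≤ py × py ≤ cy))

HooksMeet : Hook → Hook → Set
HooksMeet h k = Σ Point λ p → OnHook h p × OnHook k p

IsHookGraph : ∀ {n} → Graph n → Set
IsHookGraph {n} G = Σ (Fin n → Hook) λ h → Σ NVLine λ ℓ →
  (0ℚ < NVLine.slope ℓ) ×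
  (∀ i → OnNVLine ℓ (center (h i))) ×
  (∀ i j → i ≢ j → (Adj G i j ⇔ HooksMeet (h i) (h j)))

-- A hook whose centre lies on a line y = a x + b (a > 0) is captured, as far as
-- intersections go, by its centre height cy together with the interval
-- [cy - vlen , a (cx + hlen) + b] of heights: two such hooks meet iff each
-- centre height lies in the other's interval (the upper end is the height of
-- the line above the tip of the horizontal arm). Realise every hook by a
-- segment at coordinate cy spanning that interval, horizontal or vertical
-- according to a proper 2-colouring. Perpendicular segments then meet exactly
-- under the same crossing condition; parallel ones can only meet when the
-- condition holds, i.e. for adjacent and hence differently coloured vertices,
-- so they never do. Each segment contains (cy , cy), so y = x stabs them all.
module Submission where

open import Defs hiding (sym)
open import Data.Nat using (ℕ)
open import Data.Bool using (Bool; true; false)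
open import Data.Empty using (⊥-elim)
open import Data.Product using (_×_; _,_; proj₁; proj₂)
open import Data.Sum using (inj₁; inj₂)
open import Data.Fin using (Fin)
open import Data.Rational using (ℚ; 0ℚ; 1ℚ; _+_; _-_; _*_; -_; _≤_; _<_; _≤?_; positive)
open import Data.Rational.Properties
  using (≤-trans; ≤-total; ≤-<-trans; <-irrefl; ≰⇒>; +-identityʳ;
         +-monoʳ-≤; +-monoˡ-≤; +-monoˡ-<; neg-antimono-≤; *-monoˡ-≤-nonNeg;
         *-monoʳ-<-pos; pos⇒nonNeg; *-distribʳ-+; *-zeroˡ)
open import Relation.Nullary using (¬_; yes; no)
open import Relation.Binary.PropositionalEquality using (_≡_; _≢_; refl; sym; trans; cong; subst; subst₂)
open import Function using (_∘′_)
open import Function.Bundles using (_⇔_; mk⇔; Equivalence)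
import Function.Properties.Equivalence as ⇔

p≤p+q : ∀ p {q} → 0ℚ ≤ q → p ≤ p + q
p≤p+q p {q} 0≤q = subst (_≤ p + q) (+-identityʳ p) (+-monoʳ-≤ p 0≤q)

p-q≤p : ∀ p {q} → 0ℚ ≤ q → p - q ≤ p
p-q≤p p {q} 0≤q = subst (p - q ≤_) (+-identityʳ p) (+-monoʳ-≤ p (neg-antimono-≤ 0≤q))

strictMono⇒cancel-≤ : (f : ℚ → ℚ) → (∀ {x y} → x < y → f x < f y) →
                      ∀ {x y} → f x ≤ f y → x ≤ y
strictMono⇒cancel-≤ f mono {x} {y} fx≤fy with x ≤? y
... | yes x≤y = x≤y
... | no  x≰y = ⊥-elim (<-irrefl refl (≤-<-trans fx≤fy (mono (≰⇒> x≰y))))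

_∈[_,_] : ℚ → ℚ → ℚ → Set
x ∈[ l , u ] = l ≤ x × x ≤ u

record Bar : Set where
  constructor bar
  field
    pos lo hi : ℚ
    pos∈ : pos ∈[ lo , hi ]

  lo≤hi : lo ≤ hi
  lo≤hi = ≤-trans (proj₁ pos∈) (proj₂ pos∈)
open Bar

Crossing : Bar → Bar → Set
Crossing β γ = pos γ ∈[ lo β , hi β ] × pos β ∈[ lo γ , hi γ ]

crossing-sym : ∀ β γ → Crossing β γ → Crossing γ β
crossing-sym _ _ (γ∈β , β∈γ) = β∈γ , γ∈β

samePos⇒crossing : ∀ β γ → pos β ≡ pos γ → Crossing β γ
samePos⇒crossing β γ eq = subst (_∈[ lo β , hi β ]) eq (pos∈ β)
                        , subst (_∈[ lo γ , hi γ ]) (sym eq) (pos∈ γ)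

barSegment : Bool → Bar → Segment
barSegment true  β = hor  (pos β) (lo β) (hi β) (lo≤hi β)
barSegment false β = vert (pos β) (lo β) (hi β) (lo≤hi β)

barSegments-meet⇒crossing : ∀ o o' β γ →
  SegsMeet (barSegment o β) (barSegment o' γ) → Crossing β γ
barSegments-meet⇒crossing true  true  β γ (_ , (y≡β , _) , (y≡γ , _)) =
  samePos⇒crossing β γ (trans (sym y≡β) y≡γ)
barSegments-meet⇒crossing false false β γ (_ , (x≡β , _) , (x≡γ , _)) =
  samePos⇒crossing β γ (trans (sym x≡β) x≡γ)
barSegments-meet⇒crossing true  false β γ (_ , (refl , γ∈β) , (refl , β∈γ)) = γ∈β , β∈γ
barSegments-meet⇒crossing false true  β γ (_ , (refl , γ∈β) , (refl , β∈γ)) = γ∈β , β∈γ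

crossing⇒barSegments-meet : ∀ {o o'} β γ → o ≢ o' →
  Crossing β γ → SegsMeet (barSegment o β) (barSegment o' γ)
crossing⇒barSegments-meet {true}  {true}  _ _ o≢o' _ = ⊥-elim (o≢o' refl)
crossing⇒barSegments-meet {false} {false} _ _ o≢o' _ = ⊥-elim (o≢o' refl)
crossing⇒barSegments-meet {true}  {false} β γ _ (γ∈β , β∈γ) =
  (pos γ , pos β) , (refl , γ∈β) , (refl , β∈γ)
crossing⇒barSegments-meet {false} {true}  β γ _ (γ∈β , β∈γ) =
  (pos β , pos γ) , (refl , γ∈β) , (refl , β∈γ)

parallel⇒sameOrientation : ∀ o o' β γ →
  Parallel (barSegment o β) (barSegment o' γ) → o ≡ o'
parallel⇒sameOrientation true  true  _ _ _  = refl
parallel⇒sameOrientation false false _ _ _  = refl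
parallel⇒sameOrientation true  false _ _ ()
parallel⇒sameOrientation false true  _ _ ()

diagonal : Line
diagonal = line 1ℚ (- 1ℚ) 0ℚ λ { (() , _) }

onDiagonal : ∀ t → OnLine diagonal (t , t)
onDiagonal t = trans (sym (*-distribʳ-+ t 1ℚ (- 1ℚ))) (*-zeroˡ t)

barSegment-onDiagonal : ∀ o β → OnSeg (barSegment o β) (pos β , pos β)
barSegment-onDiagonal true  β = refl , pos∈ β
barSegment-onDiagonal false β = refl , pos∈ β

module HooksOnLine (a b : ℚ) (a>0 : 0ℚ < a) where

  private instance
    a-positive = positive a>0

  affine : ℚ → ℚ
  affine x = a * x + b

  affine-mono-≤ : ∀ {x y} → x ≤ y → affine x ≤ affine y
  affine-mono-≤ x≤y = +-monoˡ-≤ b (*-monoˡ-≤-nonNeg a {{pos⇒nonNeg a}} x≤y)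

  affine-cancel-≤ : ∀ {x y} → affine x ≤ affine y → x ≤ y
  affine-cancel-≤ = strictMono⇒cancel-≤ affine λ x<y → +-monoˡ-< b (*-monoʳ-<-pos a x<y)

  Centred : Hook → Set
  Centred h = OnNVLine (nvline a b) (center h)

  hookBar : ∀ h → Centred h → Bar
  hookBar (hook cx cy hl vl hl≥0 vl≥0) cy≡ =
    bar cy (cy - vl) (affine (cx + hl))
        (p-q≤p cy vl≥0 , subst (_≤ _) (sym cy≡) (affine-mono-≤ (p≤p+q cx hl≥0)))

  horizontal-meets-vertical⇒crossing : ∀ h k (ch : Centred h) (ck : Centred k) {px py} →
    py ≡ Hook.cy h × px ∈[ Hook.cx h , Hook.cx h + Hook.hlen h ] →
    px ≡ Hook.cx k × py ∈[ Hook.cy k - Hook.vlen k , Hook.cy k ] →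
    Crossing (hookBar h ch) (hookBar k ck)
  horizontal-meets-vertical⇒crossing h k ch ck (refl , _ , x≤tip) (refl , lo≤y , y≤cy) =
    (≤-trans (proj₁ (pos∈ (hookBar h ch))) y≤cy , subst (_≤ _) (sym ck) (affine-mono-≤ x≤tip)) ,
    (lo≤y , ≤-trans y≤cy (proj₂ (pos∈ (hookBar k ck))))

  hooksMeet⇒crossing : ∀ h k (ch : Centred h) (ck : Centred k) →
    HooksMeet h k → Crossing (hookBar h ch) (hookBar k ck)
  hooksMeet⇒crossing h k ch ck (_ , inj₁ (y≡h , _) , inj₁ (y≡k , _)) =
    samePos⇒crossing (hookBar h ch) (hookBar k ck) (trans (sym y≡h) y≡k)
  hooksMeet⇒crossing h k ch ck (_ , inj₁ hArm , inj₂ kArm) =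
    horizontal-meets-vertical⇒crossing h k ch ck hArm kArm
  hooksMeet⇒crossing h k ch ck (_ , inj₂ hArm , inj₁ kArm) =
    crossing-sym (hookBar k ck) (hookBar h ch) (horizontal-meets-vertical⇒crossing k h ck ch kArm hArm)
  hooksMeet⇒crossing h k ch ck (_ , inj₂ (x≡h , _) , inj₂ (x≡k , _)) =
    samePos⇒crossing (hookBar h ch) (hookBar k ck)
      (trans ch (trans (cong affine (trans (sym x≡h) x≡k)) (sym ck)))

  crossing⇒hooksMeet-lower : ∀ h k (ch : Centred h) (ck : Centred k) →
    Hook.cy h ≤ Hook.cy k → Crossing (hookBar h ch) (hookBar k ck) → HooksMeet h k
  crossing⇒hooksMeet-lower h@(hook cx cy _ _ _ _) k@(hook cx' cy' _ _ _ _) ch ck cy≤cy'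
                           ((_ , cy'≤tip) , (lo'≤cy , _)) =
    (cx' , cy) ,
    inj₁ (refl , affine-cancel-≤ (subst₂ _≤_ ch ck cy≤cy') , affine-cancel-≤ (subst (_≤ _) ck cy'≤tip)) ,
    inj₂ (refl , lo'≤cy , cy≤cy')

  crossing⇒hooksMeet : ∀ h k (ch : Centred h) (ck : Centred k) →
    Crossing (hookBar h ch) (hookBar k ck) → HooksMeet h k
  crossing⇒hooksMeet h k ch ck c with ≤-total (Hook.cy h) (Hook.cy k)
  ... | inj₁ h≤k = crossing⇒hooksMeet-lower h k ch ck h≤k c
  ... | inj₂ k≤h with crossing⇒hooksMeet-lower k h ck ch k≤h (crossing-sym (hookBar h ch) (hookBar k ck) c)
  ...   | p , onK , onH = p , onH , onK

  hooksMeet⇔crossing : ∀ h k (ch : Centred h) (ck : Centred k) →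
    HooksMeet h k ⇔ Crossing (hookBar h ch) (hookBar k ck)
  hooksMeet⇔crossing h k ch ck = mk⇔ (hooksMeet⇒crossing h k ch ck) (crossing⇒hooksMeet h k ch ck)

proposition2 : ∀ (n : ℕ) (G : Graph n) → IsHookGraph G × Bipartite G → IsStabGIG G
proposition2 n G ((h , nvline a b , a>0 , centred , adj⇔meet) , (colour , proper)) =
  segment , (parallel-disjoint , adj⇔segsMeet) , diagonal ,
  λ i → (pos (β i) , pos (β i)) , barSegment-onDiagonal (colour i) (β i) , onDiagonal (pos (β i))
  where
  open HooksOnLine a b a>0

  β : Fin n → Bar
  β i = hookBar (h i) (centred i)

  segment : Fin n → Segment
  segment i = barSegment (colour i) (β i)

  adj⇔crossing : ∀ i j → i ≢ j → Adj G i j ⇔ Crossing (β i) (β j)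
  adj⇔crossing i j i≢j = ⇔.trans (adj⇔meet i j i≢j) (hooksMeet⇔crossing (h i) (h j) (centred i) (centred j))

  segsMeet⇒adj : ∀ i j → i ≢ j → SegsMeet (segment i) (segment j) → Adj G i j
  segsMeet⇒adj i j i≢j = Equivalence.from (adj⇔crossing i j i≢j)
                        ∘′ barSegments-meet⇒crossing (colour i) (colour j) (β i) (β j)

  parallel-disjoint : ∀ i j → i ≢ j → Parallel (segment i) (segment j) → ¬ SegsMeet (segment i) (segment j)
  parallel-disjoint i j i≢j par meet =
    proper i j (segsMeet⇒adj i j i≢j meet) (parallel⇒sameOrientation (colour i) (colour j) (β i) (β j) par)

  adj⇔segsMeet : ∀ i j → i ≢ j → Adj G i j ⇔ SegsMeet (segment i) (segment j)
  adj⇔segsMeet i j i≢j = mk⇔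
    (λ ij → crossing⇒barSegments-meet (β i) (β j) (proper i j ij) (Equivalence.to (adj⇔crossing i j i≢j) ij))
    (segsMeet⇒adj i j i≢j)
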